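{- Let $n,k\ge 1$ and let $\rho=(2n+k-1,2n+k-3,\ldots,k+3,k-3,2,2)$ (the first $n-1$ parts being $2n+k-2i+1$ for $1\le i\le n-1$, followed by $k-3,2,2$). Let $T$ be a special rim hook tabloid of shape $\rho$ and content $\lambda$ such that $\mathrm{SCP}_{\mathbf{(n+k)}\times\mathbf{n},\lambda}\ne\emptyset$. Then $\lambda_i=\rho_i=2n+k-2i+1$ for all $1\le i\le n-1$.
   Context: $\mathbf{m}$ denotes the $m$-element chain and $\mathbf{m}\times\mathbf{n}$ the product poset. A chain partition of a finite poset $P$ is a partition of $P$ into chains; a semi-ordered chain partition is a chain partition whose blocks are listed as a sequence in weakly decreasing order of size, with blocks of equal size also ordered (so different orderings of equal-size blocks count as different). $\mathrm{SCP}_{P,\lambda}$ is the set of semi-ordered chain partitions of $P$ whose block sizes form the partition $\lambda$. Ferrers diagrams are drawn with rows left-justified and indexed from bottom to top, row $i$ having $\lambda_i$ boxes. A rim hook of a shape is a connected set of boxes containing no $2\times 2$ square whose removal leaves a Ferrers diagram of a partition; a rim hook tabloid of shape $\lambda$ is a decomposition of the diagram obtained by successively removing rim hooks until nothing is left; it is special if every rim hook contains a box in the first column. Its content is the partition formed by the sizes of its rim hooks. -}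

module Defs where

open import Data.Nat using (ℕ; zero; suc; _+_; _*_; _∸_; _≤_; _<_; _≥_)
open import Data.Fin using (Fin)
import Data.Fin as F
open import Data.List using (List; []; _∷_; _++_; map; length; concat; applyUpTo; cartesianProduct; allFin)
open import Data.Nat.ListAction using (sum)
open import Data.List.Relation.Unary.All using (All)
open import Data.List.Relation.Unary.Linked using (Linked)
open import Data.List.Membership.Propositional using (_∈_)
open import Data.List.Relation.Binary.Permutation.Propositional using (_↭_)
open import Data.Product using (_×_; _,_; ∃; Σ)
open import Data.Sum using (_⊎_)
open import Relation.Binary.PropositionalEquality using (_≡_)
open import Relation.Nullary using (¬_)

-- Partitions / Ferrers diagrams.
-- A shape is a list of row lengths, row 0 (= λ_1 in the paper) at the
-- bottom.  Indices here are 0-based: (row λ i) is the paper's λ_{i+1}.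

row : List ℕ → ℕ → ℕ
row []       _       = 0
row (x ∷ xs) zero    = x
row (x ∷ xs) (suc i) = row xs i

IsPartition : List ℕ → Set
IsPartition λs = Linked _≥_ λs × All (λ x → 0 < x) λs

Cell : Set
Cell = ℕ × ℕ   -- (row index i, column index j), both 0-based

InSkew : List ℕ → List ℕ → Cell → Set
InSkew α β (i , j) = row β i ≤ j × j < row α i

Adjacent : Cell → Cell → Set
Adjacent (i , j) (i' , j') =
  (i ≡ i' × (suc j ≡ j' ⊎ j ≡ suc j')) ⊎ (j ≡ j' × (suc i ≡ i' ⊎ i ≡ suc i'))

data PathIn (α β : List ℕ) : Cell → Cell → Set where
  here  : ∀ {c} → PathIn α β c c
  there : ∀ {c c' d} → Adjacent c c' → InSkew α β c' → PathIn α β c' d → PathIn α β c d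

record RimHook (α β : List ℕ) : Set where
  field
    shapePart   : IsPartition α
    restPart    : IsPartition β
    contained   : ∀ i → row β i ≤ row α i
    nonempty    : ∃ λ c → InSkew α β c
    connected   : ∀ c d → InSkew α β c → InSkew α β d → PathIn α β c d
    noSquare    : ∀ i j → ¬ (InSkew α β (i , j) × InSkew α β (suc i , j)
                             × InSkew α β (i , suc j) × InSkew α β (suc i , suc j))

HitsFirstColumn : List ℕ → List ℕ → Set
HitsFirstColumn α β = ∃ λ i → InSkew α β (i , 0)

-- Special rim hook tabloids of shape α; the second index is the list of
-- the sizes of the rim hooks, in order of removal.
data SpecialRHT : List ℕ → List ℕ → Set where
  done   : SpecialRHT [] []
  remove : ∀ {α β s} → RimHook α β → HitsFirstColumn α β →
           SpecialRHT β s → SpecialRHT α ((sum α ∸ sum β) ∷ s)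

HasContent : ∀ {α s} → SpecialRHT α s → List ℕ → Set
HasContent {s = s} _ λs = IsPartition λs × s ↭ λs

Elem : ℕ → ℕ → Set
Elem m n = Fin m × Fin n

_≼_ : ∀ {m n} → Elem m n → Elem m n → Set
(a , b) ≼ (c , d) = a F.≤ c × b F.≤ d

Comparable : ∀ {m n} → Elem m n → Elem m n → Set
Comparable x y = x ≼ y ⊎ y ≼ x

IsChain : ∀ {m n} → List (Elem m n) → Set
IsChain b = ∀ x y → x ∈ b → y ∈ b → Comparable x y

elems : ∀ m n → List (Elem m n)
elems m n = cartesianProduct (allFin m) (allFin n)

record SCP (m n : ℕ) (λs : List ℕ) : Set where
  field
    blocks  : List (List (Elem m n))
    chains  : All IsChain blocks
    sizes   : map length blocks ≡ λs
    isPart  : concat blocks ↭ elems m n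

-- ρ = (2n+k-1, 2n+k-3, …, k+3, k-3, 2, 2)
-- (first n-1 parts 2n+k-2i+1 for 1 ≤ i ≤ n-1; the 0-based index j = i-1)

rho : ℕ → ℕ → List ℕ
rho n k = applyUpTo (λ j → (2 * n + k + 1) ∸ 2 * suc j) (n ∸ 1) ++ (k ∸ 3 ∷ 2 ∷ 2 ∷ [])

-- Write Λ_t and P_t for the sums of the first t parts of λ and ρ.
-- Peeling the special rim hooks off T one at a time, every hook that meets the
-- first t rows pays for one of those rows, so P_t is bounded by a sum of at most
-- t hook sizes, hence P_t ≤ Λ_t.
-- Conversely, put d = 2n + k − 2t.  A chain of (n + k) × n meets each level at
-- most once, so t chains contain at most t (d + 1) elements of the d + 1 middle
-- levels, while the t − 1 levels below and the t − 1 levels above them hold at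
-- most t (t − 1) elements; thus Λ_t ≤ t (d + 1) + t (t − 1) = P_t for t ≤ n − 1.
-- Equal partial sums give λ_i = ρ_i for i < n − 1.

module Submission where

open import Defs
open import Data.Nat using (ℕ; zero; suc; _+_; _*_; _∸_; _≤_; _<_; _≥_; z≤n; s≤s; _<?_; _≤?_; _≟_)
open import Data.Nat.Properties
open import Data.Nat.ListAction using (sum)
open import Data.Nat.ListAction.Properties using (sum-++; sum-↭)
open import Data.Nat.Tactic.RingSolver using (solve-∀)
open import Data.Fin using (Fin; toℕ; fromℕ<)
import Data.Fin as Fin
open import Data.Fin.Properties using (toℕ-injective; toℕ-fromℕ<; injective⇒≤)
open import Data.List
  using (List; []; _∷_; _++_; length; map; concat; filter; lookup; take; allFin; cartesianProduct; tabulate; applyUpTo)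
open import Data.List.Properties using (map-++; map-∘; map-tabulate)
open import Data.List.Relation.Unary.All as All using (All; []; _∷_)
open import Data.List.Relation.Unary.All.Properties using (all-filter; ++⁻ˡ)
open import Data.List.Relation.Unary.AllPairs using ([]; _∷_)
open import Data.List.Relation.Unary.Linked as Linked using (Linked; []; [-]; _∷_)
open import Data.List.Relation.Unary.Unique.Propositional using (Unique)
import Data.List.Relation.Unary.Unique.Propositional.Properties as Unique
open import Data.List.Membership.Propositional using (_∈_)
open import Data.List.Membership.Propositional.Properties using (∈-lookup; ∈-filter⁻)
open import Data.List.Relation.Binary.Permutation.Propositional as ↭ using (_↭_; ↭-sym; ↭⇒↭ₛ)
open import Data.List.Relation.Binary.Permutation.Propositional.Properties using (map⁺)
open import Data.List.Relation.Binary.Permutation.Setoid.Properties using (Unique-resp-↭)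
open import Data.Product using (_×_; _,_; ∃; proj₁; proj₂)
open import Data.Sum using (inj₁; inj₂)
open import Data.Empty using (⊥-elim)
open import Relation.Binary.PropositionalEquality
  using (_≡_; refl; sym; trans; cong; cong₂; subst; setoid; module ≡-Reasoning)
open import Relation.Nullary using (¬_; Dec; yes; no)
open import Relation.Unary using (Decidable)

∑< : ℕ → (ℕ → ℕ) → ℕ
∑< zero    f = 0
∑< (suc N) f = f 0 + ∑< N (λ i → f (suc i))
syntax ∑< N (λ i → e) = ∑[ i < N ] e

∑-cong : ∀ N {f g} → (∀ i → i < N → f i ≡ g i) → ∑< N f ≡ ∑< N g
∑-cong zero    f≡g = refl
∑-cong (suc N) f≡g = cong₂ _+_ (f≡g 0 (s≤s z≤n)) (∑-cong N (λ i i<N → f≡g (suc i) (s≤s i<N)))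

∑-mono-≤ : ∀ N {f g} → (∀ i → i < N → f i ≤ g i) → ∑< N f ≤ ∑< N g
∑-mono-≤ zero    f≤g = z≤n
∑-mono-≤ (suc N) f≤g = +-mono-≤ (f≤g 0 (s≤s z≤n)) (∑-mono-≤ N (λ i i<N → f≤g (suc i) (s≤s i<N)))

∑-zero : ∀ N → ∑[ i < N ] 0 ≡ 0
∑-zero zero    = refl
∑-zero (suc N) = ∑-zero N

∑-snoc : ∀ N f → ∑< (suc N) f ≡ ∑< N f + f N
∑-snoc zero    f = +-comm (f 0) 0
∑-snoc (suc N) f = begin
  f 0 + ∑< (suc N) (λ i → f (suc i))          ≡⟨ cong (f 0 +_) (∑-snoc N (λ i → f (suc i))) ⟩
  f 0 + (∑< N (λ i → f (suc i)) + f (suc N))  ≡⟨ +-assoc (f 0) _ _ ⟨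
  ∑< (suc N) f + f (suc N)                    ∎
  where open ≡-Reasoning

∑-distrib-+ : ∀ N f g → ∑[ i < N ] (f i + g i) ≡ ∑< N f + ∑< N g
∑-distrib-+ zero    f g = refl
∑-distrib-+ (suc N) f g
  rewrite ∑-distrib-+ N (λ i → f (suc i)) (λ i → g (suc i)) = interchange (f 0) (g 0) _ _
  where
  interchange : ∀ a b c d → a + b + (c + d) ≡ a + c + (b + d)
  interchange = solve-∀

∑-split : ∀ a e f → ∑< (a + e) f ≡ ∑< a f + ∑[ j < e ] f (a + j)
∑-split zero    e f = refl
∑-split (suc a) e f rewrite ∑-split a e (λ i → f (suc i)) = sym (+-assoc (f 0) _ _)

∑-≤-length : ∀ N f → (∀ i → f i ≤ 1) → ∑< N f ≤ N
∑-≤-length zero    f f≤1 = z≤n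
∑-≤-length (suc N) f f≤1 = +-mono-≤ (f≤1 0) (∑-≤-length N _ (λ i → f≤1 (suc i)))

∑-+-∸ : ∀ N {f g} → (∀ i → f i ≤ g i) → ∑< N g ≡ ∑< N f + ∑[ i < N ] (g i ∸ f i)
∑-+-∸ N {f} {g} f≤g =
  trans (∑-cong N (λ i _ → sym (m+[n∸m]≡n (f≤g i)))) (∑-distrib-+ N f (λ i → g i ∸ f i))

prefix-sums-determine : ∀ {f g : ℕ → ℕ} N → (∀ t → t ≤ N → ∑< t f ≡ ∑< t g) →
                        ∀ {i} → i < N → f i ≡ g i
prefix-sums-determine {f} {g} N prefix≡ {i} i<N = +-cancelˡ-≡ (∑< i f) _ _ (begin
  ∑< i f + f i          ≡⟨ ∑-snoc i f ⟨
  ∑< (suc i) f          ≡⟨ prefix≡ (suc i) i<N ⟩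
  ∑< (suc i) g          ≡⟨ ∑-snoc i g ⟩
  ∑< i g + g i          ≡⟨ cong (_+ g i) (prefix≡ i (<⇒≤ i<N)) ⟨
  ∑< i f + g i          ∎)
  where open ≡-Reasoning

row-≥-length : ∀ xs i → length xs ≤ i → row xs i ≡ 0
row-≥-length []       i       _         = refl
row-≥-length (x ∷ xs) (suc i) (s≤s len≤i) = row-≥-length xs i len≤i

sum≡∑row : ∀ xs L → length xs ≤ L → sum xs ≡ ∑[ i < L ] row xs i
sum≡∑row []       L       _         = sym (∑-zero L)
sum≡∑row (x ∷ xs) (suc L) (s≤s len≤L) = cong (x +_) (sum≡∑row xs L len≤L)

row-suc-≤ : ∀ {xs} → Linked _≥_ xs → ∀ i → row xs (suc i) ≤ row xs i
row-suc-≤ []       i       = z≤n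
row-suc-≤ [-]      i       = z≤n
row-suc-≤ (x≥y ∷ _) zero    = x≥y
row-suc-≤ (_ ∷ xs↓) (suc i) = row-suc-≤ xs↓ i

row-antitone : ∀ {xs} → Linked _≥_ xs → ∀ {i j} → i ≤ j → row xs j ≤ row xs i
row-antitone {xs} xs↓ {i} {j} i≤j with m≤n⇒∃[o]m+o≡n i≤j
... | o , refl = go o
  where
  go : ∀ o → row xs (i + o) ≤ row xs i
  go zero    rewrite +-identityʳ i = ≤-refl
  go (suc o) rewrite +-suc i o     = ≤-trans (row-suc-≤ xs↓ (i + o)) (go o)

-- Special rim hooks and tabloids

telescope : ∀ (α β : ℕ → ℕ) → (∀ i → β i ≤ α (suc i)) →
            ∀ e → α 0 ≤ ∑[ j < e ] (α j ∸ β j) + α e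
telescope α β β≤α zero    = ≤-refl
telescope α β β≤α (suc e) = begin
  α 0                                      ≤⟨ m≤n+m∸n (α 0) (β 0) ⟩
  β 0 + (α 0 ∸ β 0)                        ≤⟨ +-monoˡ-≤ (α 0 ∸ β 0) (β≤α 0) ⟩
  α 1 + (α 0 ∸ β 0)                        ≤⟨ +-monoˡ-≤ (α 0 ∸ β 0) rest ⟩
  ∑[ j < e ] (α (suc j) ∸ β (suc j)) + α (suc e) + (α 0 ∸ β 0)
    ≡⟨ rotate (∑[ j < e ] (α (suc j) ∸ β (suc j))) (α (suc e)) (α 0 ∸ β 0) ⟩
  ∑[ j < suc e ] (α j ∸ β j) + α (suc e)   ∎
  where
  open ≤-Reasoning
  rest : α 1 ≤ ∑[ j < e ] (α (suc j) ∸ β (suc j)) + α (suc e)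
  rest = telescope (λ i → α (suc i)) (λ i → β (suc i)) (λ i → β≤α (suc i)) e
  rotate : ∀ s a d → s + a + d ≡ d + s + a
  rotate = solve-∀

-- A step of the path from row i up to row i + 1 stays in a column j with
-- row β i ≤ j (its lower cell is not in β) and j < row α (suc i).
pathIn-crossing : ∀ {α β c d} i → PathIn α β c d → InSkew α β c →
                  proj₁ c ≤ i → i < proj₁ d → row β i < row α (suc i)
pathIn-crossing i here c∈ c≤i i<d = ⊥-elim (<-irrefl refl (≤-<-trans c≤i i<d))
pathIn-crossing {c = ci , _} i (there {c' = i' , _} adj c'∈ p) c∈ ci≤i i<d with i' ≤? i
... | yes i'≤i = pathIn-crossing i p c'∈ i'≤i i<d
... | no  i'≰i with adj
...   | inj₁ (refl , _)       = ⊥-elim (i'≰i ci≤i)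
...   | inj₂ (refl , inj₂ refl) = ⊥-elim (i'≰i (≤-trans (n≤1+n i') ci≤i))
...   | inj₂ (refl , inj₁ refl) with ≤-antisym ci≤i (≤-pred (≰⇒> i'≰i))
...     | refl = ≤-<-trans (proj₁ c∈) (proj₂ c'∈)

specialRimHook-interlaces : ∀ {α β} → RimHook α β → HitsFirstColumn α β →
                            ∀ {a} → row β a < row α a →
                            ∀ {i} → a ≤ i → row β i ≤ row α (suc i)
specialRimHook-interlaces {α} {β} h (b , b0∈) {a} βa<αa {i} a≤i with b ≤? i
... | yes b≤i = ≤-trans (≤-trans (row-antitone (proj₁ restPart) b≤i) (proj₁ b0∈)) z≤n
  where open RimHook h
... | no  b≰i = <⇒≤ (pathIn-crossing i (connected _ _ a∈ b0∈) a∈ a≤i (≰⇒> b≰i))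
  where
  open RimHook h
  a∈ : InSkew α β (a , row β a)
  a∈ = ≤-refl , βa<αa

rimHook-size : ∀ {α β} → RimHook α β → ∀ L → length α ≤ L → length β ≤ L →
               sum α ∸ sum β ≡ ∑[ i < L ] (row α i ∸ row β i)
rimHook-size {α} {β} h L |α|≤L |β|≤L
  rewrite sum≡∑row α L |α|≤L | sum≡∑row β L |β|≤L | ∑-+-∸ L (RimHook.contained h) =
  m+n∸m≡n (∑< L (row β)) _

-- Rows t, t+1, … of α interlace with those of β, so telescoping pays for
-- row t of α with the part of the hook lying in rows t and above.
specialRimHook-covers : ∀ {α β} → RimHook α β → HitsFirstColumn α β →
  ∀ {a t} → a ≤ t → row β a < row α a →
  ∑[ i < suc t ] row α i ≤ (sum α ∸ sum β) + ∑[ i < t ] row β i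
specialRimHook-covers {α} {β} h hits {a} {t} a≤t βa<αa = begin
  ∑< (suc t) A                                  ≡⟨ ∑-snoc t A ⟩
  ∑< t A + A t                                  ≡⟨ cong (_+ A t) (∑-+-∸ t contained) ⟩
  ∑< t B + ∑< t D + A t                         ≤⟨ +-monoʳ-≤ (∑< t B + ∑< t D) rowt≤hookAbove ⟩
  ∑< t B + ∑< t D + ∑[ j < e ] D (t + j)        ≡⟨ +-assoc (∑< t B) _ _ ⟩
  ∑< t B + (∑< t D + ∑[ j < e ] D (t + j))      ≡⟨ cong (∑< t B +_) (∑-split t e D) ⟨
  ∑< t B + ∑< L D                               ≡⟨ +-comm (∑< t B) _ ⟩
  ∑< L D + ∑< t B                               ≡⟨ cong (_+ ∑< t B) (rimHook-size h L |α|≤L |β|≤L) ⟨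
  (sum α ∸ sum β) + ∑< t B                      ∎
  where
  open ≤-Reasoning
  open RimHook h using (contained)
  A B D : ℕ → ℕ
  A = row α
  B = row β
  D i = A i ∸ B i
  e = length α + length β
  L = t + e
  |α|≤L : length α ≤ L
  |α|≤L = ≤-trans (m≤m+n (length α) (length β)) (m≤n+m e t)
  |β|≤L : length β ≤ L
  |β|≤L = ≤-trans (m≤n+m (length β) (length α)) (m≤n+m e t)
  interlaced : ∀ j → B (t + j) ≤ A (t + suc j)
  interlaced j = subst (λ u → B (t + j) ≤ A u) (sym (+-suc t j))
                   (specialRimHook-interlaces h hits βa<αa (≤-trans a≤t (m≤m+n t j)))
  rowt≤hookAbove : A t ≤ ∑[ j < e ] D (t + j)
  rowt≤hookAbove = begin
    A t                                 ≡⟨ cong A (+-identityʳ t) ⟨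
    A (t + 0)                           ≤⟨ telescope (λ j → A (t + j)) (λ j → B (t + j)) interlaced e ⟩
    ∑[ j < e ] D (t + j) + A L          ≡⟨ cong (∑[ j < e ] D (t + j) +_) (row-≥-length α L |α|≤L) ⟩
    ∑[ j < e ] D (t + j) + 0            ≡⟨ +-identityʳ _ ⟩
    ∑[ j < e ] D (t + j)                ∎

data SubSum : List ℕ → ℕ → ℕ → Set where
  []   : ∀ {t} → SubSum [] t 0
  skip : ∀ {x xs t s} → SubSum xs t s → SubSum (x ∷ xs) t s
  pick : ∀ {x xs t s} → SubSum xs t s → SubSum (x ∷ xs) (suc t) (x + s)

SubSum-↭ : ∀ {xs ys t s} → xs ↭ ys → SubSum xs t s → SubSum ys t s
SubSum-↭ ↭.refl            p               = p
SubSum-↭ (↭.prep x xs↭ys)  (skip p)        = skip (SubSum-↭ xs↭ys p)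
SubSum-↭ (↭.prep x xs↭ys)  (pick p)        = pick (SubSum-↭ xs↭ys p)
SubSum-↭ (↭.swap x y xs↭ys) (skip (skip p)) = skip (skip (SubSum-↭ xs↭ys p))
SubSum-↭ (↭.swap x y xs↭ys) (skip (pick p)) = pick (skip (SubSum-↭ xs↭ys p))
SubSum-↭ (↭.swap x y xs↭ys) (pick (skip p)) = skip (pick (SubSum-↭ xs↭ys p))
SubSum-↭ (↭.swap x y xs↭ys) (pick (pick {s = s} p)) =
  subst (SubSum _ _) (x+[y+s]≡y+[x+s] y x s) (pick (pick (SubSum-↭ xs↭ys p)))
  where
  x+[y+s]≡y+[x+s] : ∀ x y s → x + (y + s) ≡ y + (x + s)
  x+[y+s]≡y+[x+s] = solve-∀
SubSum-↭ (↭.trans p q)     r               = SubSum-↭ q (SubSum-↭ p r)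

SubSum≤∑row : ∀ {xs t s} → Linked _≥_ xs → SubSum xs t s → s ≤ ∑[ i < t ] row xs i
SubSum≤∑row xs↓ []       = z≤n
SubSum≤∑row {t = t} xs↓ (skip p) =
  ≤-trans (SubSum≤∑row (Linked.tail xs↓) p) (∑-mono-≤ t (λ i _ → row-suc-≤ xs↓ i))
SubSum≤∑row xs↓ (pick p) = +-monoʳ-≤ _ (SubSum≤∑row (Linked.tail xs↓) p)

specialRHT-subSum : ∀ {α s} → SpecialRHT α s → ∀ t →
                    ∃ λ x → SubSum s t x × ∑[ i < t ] row α i ≤ x
specialRHT-subSum done t = 0 , [] , ≤-reflexive (∑-zero t)
specialRHT-subSum (remove h hits T) zero with specialRHT-subSum T zero
... | x , p , _ = x , skip p , z≤n
specialRHT-subSum {α} (remove {β = β} h hits T) (suc t)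
  with anyUpTo? (λ a → row β a <? row α a) (suc t)
... | yes (a , s≤s a≤t , βa<αa) with specialRHT-subSum T t
...   | x , p , ∑β≤x =
  _ , pick p , ≤-trans (specialRimHook-covers h hits a≤t βa<αa) (+-monoʳ-≤ (sum α ∸ sum β) ∑β≤x)
specialRHT-subSum {α} (remove {β = β} h hits T) (suc t)
    | no untouched with specialRHT-subSum T (suc t)
...   | x , p , ∑β≤x =
  x , skip p , ≤-trans (∑-mono-≤ (suc t) rows-kept) ∑β≤x
  where
  rows-kept : ∀ a → a < suc t → row α a ≤ row β a
  rows-kept a a<t = ≮⇒≥ (λ βa<αa → untouched (a , a<t , βa<αa))

specialRHT-dominance : ∀ {α s} (T : SpecialRHT α s) (λs : List ℕ) → HasContent T λs →
                       ∀ t → ∑[ i < t ] row α i ≤ ∑[ i < t ] row λs i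
specialRHT-dominance T λs (λs-partition , s↭λs) t with specialRHT-subSum T t
... | x , p , ∑α≤x = ≤-trans ∑α≤x (SubSum≤∑row (proj₁ λs-partition) (SubSum-↭ s↭λs p))

Unique-lookup-injective : ∀ {A : Set} {xs : List A} → Unique xs →
                          ∀ {i j} → lookup xs i ≡ lookup xs j → i ≡ j
Unique-lookup-injective (_  ∷ _) {Fin.zero}  {Fin.zero}  _  = refl
Unique-lookup-injective (x∉ ∷ _) {Fin.zero}  {Fin.suc j} eq = ⊥-elim (All.lookup x∉ (∈-lookup j) eq)
Unique-lookup-injective (x∉ ∷ _) {Fin.suc i} {Fin.zero}  eq = ⊥-elim (All.lookup x∉ (∈-lookup i) (sym eq))
Unique-lookup-injective (_  ∷ u) {Fin.suc i} {Fin.suc j} eq = cong Fin.suc (Unique-lookup-injective u eq)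

unique-length-≤ : ∀ {A : Set} {xs : List A} (g : A → ℕ) {N} → Unique xs →
                  All (λ x → g x < N) xs →
                  (∀ {x y} → x ∈ xs → y ∈ xs → g x ≡ g y → x ≡ y) → length xs ≤ N
unique-length-≤ {xs = xs} g uniq g<N g-injective = injective⇒≤ {f = f} f-injective
  where
  f : Fin (length xs) → Fin _
  f i = fromℕ< (All.lookup g<N (∈-lookup i))
  f-injective : ∀ {i j} → f i ≡ f j → i ≡ j
  f-injective {i} {j} fi≡fj = Unique-lookup-injective uniq
    (g-injective (∈-lookup i) (∈-lookup j)
      (trans (sym (toℕ-fromℕ< _)) (trans (cong toℕ fi≡fj) (toℕ-fromℕ< _))))

Unique-↭ : ∀ {A : Set} {xs ys : List A} → xs ↭ ys → Unique xs → Unique ys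
Unique-↭ {A} xs↭ys = Unique-resp-↭ (setoid A) (↭⇒↭ₛ xs↭ys)

Unique-++⁻ : ∀ {A : Set} (xs : List A) {ys} → Unique (xs ++ ys) → Unique xs × Unique ys
Unique-++⁻ []       u        = [] , u
Unique-++⁻ (x ∷ xs) (x∉ ∷ u) with Unique-++⁻ xs u
... | uxs , uys = (++⁻ˡ xs x∉ ∷ uxs) , uys

Unique-concat⁻ : ∀ {A : Set} (xss : List (List A)) → Unique (concat xss) → All Unique xss
Unique-concat⁻ []         _ = []
Unique-concat⁻ (xs ∷ xss) u with Unique-++⁻ xs u
... | uxs , uxss = uxs ∷ Unique-concat⁻ xss uxss

length≤filter+∑ : ∀ {A : Set} {P : A → Set} (P? : Decidable P) (f : A → ℕ) →
                  (∀ x → ¬ P x → 1 ≤ f x) → ∀ xs → length xs ≤ length (filter P? xs) + sum (map f xs)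
length≤filter+∑ P? f 1≤f []       = z≤n
length≤filter+∑ P? f 1≤f (x ∷ xs) with P? x
... | yes _  = s≤s (≤-trans (length≤filter+∑ P? f 1≤f xs)
                            (+-monoʳ-≤ (length (filter P? xs)) (m≤n+m (sum (map f xs)) (f x))))
... | no ¬Px = begin
  suc (length xs)                                  ≤⟨ s≤s (length≤filter+∑ P? f 1≤f xs) ⟩
  suc (length (filter P? xs) + sum (map f xs))     ≡⟨ +-suc _ _ ⟨
  length (filter P? xs) + suc (sum (map f xs))     ≤⟨ +-monoʳ-≤ _ (+-monoˡ-≤ _ (1≤f x ¬Px)) ⟩
  length (filter P? xs) + (f x + sum (map f xs))   ∎
  where open ≤-Reasoning

sum-map-concat-take : ∀ {A : Set} (f : A → ℕ) t (xss : List (List A)) →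
                      sum (map f (concat (take t xss))) ≤ sum (map f (concat xss))
sum-map-concat-take f zero    xss        = z≤n
sum-map-concat-take f (suc t) []         = ≤-refl
sum-map-concat-take f (suc t) (xs ∷ xss)
  rewrite map-++ f xs (concat (take t xss)) | map-++ f xs (concat xss)
        | sum-++ (map f xs) (map f (concat (take t xss))) | sum-++ (map f xs) (map f (concat xss)) =
  +-monoʳ-≤ (sum (map f xs)) (sum-map-concat-take f t xss)

sum-tabulate : ∀ N (f : Fin N → ℕ) (F : ℕ → ℕ) → (∀ i → f i ≡ F (toℕ i)) →
               sum (tabulate f) ≡ ∑< N F
sum-tabulate zero    f F f≡F = refl
sum-tabulate (suc N) f F f≡F =
  cong₂ _+_ (f≡F Fin.zero) (sum-tabulate N (λ i → f (Fin.suc i)) (λ i → F (suc i)) (λ i → f≡F (Fin.suc i)))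

sum-map-cartesianProduct : ∀ {A B : Set} (f : A × B → ℕ) xs ys →
  sum (map f (cartesianProduct xs ys)) ≡ sum (map (λ x → sum (map (λ y → f (x , y)) ys)) xs)
sum-map-cartesianProduct f []       ys = refl
sum-map-cartesianProduct f (x ∷ xs) ys = begin
  sum (map f (map (x ,_) ys ++ cartesianProduct xs ys))
    ≡⟨ cong sum (map-++ f (map (x ,_) ys) (cartesianProduct xs ys)) ⟩
  sum (map f (map (x ,_) ys) ++ map f (cartesianProduct xs ys))
    ≡⟨ sum-++ (map f (map (x ,_) ys)) _ ⟩
  sum (map f (map (x ,_) ys)) + sum (map f (cartesianProduct xs ys))
    ≡⟨ cong₂ _+_ (cong sum (sym (map-∘ ys))) (sum-map-cartesianProduct f xs ys) ⟩
  sum (map (λ y → f (x , y)) ys) + sum (map (λ x → sum (map (λ y → f (x , y)) ys)) xs) ∎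
  where open ≡-Reasoning

-- Levels of m × n

𝟙[_≤_] : ℕ → ℕ → ℕ
𝟙[ zero  ≤ n     ] = 1
𝟙[ suc m ≤ zero  ] = 0
𝟙[ suc m ≤ suc n ] = 𝟙[ m ≤ n ]

𝟙≤1 : ∀ m n → 𝟙[ m ≤ n ] ≤ 1
𝟙≤1 zero    n       = ≤-refl
𝟙≤1 (suc m) zero    = z≤n
𝟙≤1 (suc m) (suc n) = 𝟙≤1 m n

𝟙-yes : ∀ {m n} → m ≤ n → 𝟙[ m ≤ n ] ≡ 1
𝟙-yes z≤n       = refl
𝟙-yes (s≤s m≤n) = 𝟙-yes m≤n

𝟙-no : ∀ {m n} → ¬ m ≤ n → 𝟙[ m ≤ n ] ≡ 0
𝟙-no {zero}          m≰n = ⊥-elim (m≰n z≤n)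
𝟙-no {suc m} {zero}  m≰n = refl
𝟙-no {suc m} {suc n} m≰n = 𝟙-no (λ m≤n → m≰n (s≤s m≤n))

𝟙≡0⇒≰ : ∀ {m n} → 𝟙[ m ≤ n ] ≡ 0 → ¬ m ≤ n
𝟙≡0⇒≰ 𝟙≡0 m≤n with () ← trans (sym 𝟙≡0) (𝟙-yes m≤n)

∑-𝟙-lower : ∀ c M N → ∑[ b < N ] 𝟙[ c + b ≤ M ] ≤ suc M ∸ c
∑-𝟙-lower c M zero = z≤n
∑-𝟙-lower c M (suc N) rewrite ∑-snoc N (λ b → 𝟙[ c + b ≤ M ]) with c + N ≤? M
... | yes c+N≤M = begin
  ∑[ b < N ] 𝟙[ c + b ≤ M ] + 𝟙[ c + N ≤ M ]
    ≤⟨ +-mono-≤ (∑-≤-length N _ (λ b → 𝟙≤1 (c + b) M)) (𝟙≤1 (c + N) M) ⟩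
  N + 1
    ≡⟨ +-comm N 1 ⟩
  suc N
    ≤⟨ m+n≤o⇒m≤o∸n (suc N) (s≤s (subst (_≤ M) (+-comm c N) c+N≤M)) ⟩
  suc M ∸ c ∎
  where open ≤-Reasoning
... | no  c+N≰M rewrite 𝟙-no c+N≰M | +-identityʳ (∑[ b < N ] 𝟙[ c + b ≤ M ]) = ∑-𝟙-lower c M N

∑-𝟙-upper : ∀ c M N → ∑[ b < N ] 𝟙[ M ≤ c + b ] ≤ (N + c) ∸ M
∑-𝟙-upper c M zero = z≤n
∑-𝟙-upper c M (suc N) rewrite ∑-snoc N (λ b → 𝟙[ M ≤ c + b ]) with M ≤? c + N
... | yes M≤c+N = begin
  ∑[ b < N ] 𝟙[ M ≤ c + b ] + 𝟙[ M ≤ c + N ]  ≤⟨ +-mono-≤ (∑-𝟙-upper c M N) (𝟙≤1 M (c + N)) ⟩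
  (N + c) ∸ M + 1                              ≡⟨ +-∸-comm 1 (subst (M ≤_) (+-comm c N) M≤c+N) ⟨
  (N + c + 1) ∸ M                              ≡⟨ cong (_∸ M) (+-comm (N + c) 1) ⟩
  (suc N + c) ∸ M                              ∎
  where open ≤-Reasoning
... | no  M≰c+N rewrite 𝟙-no M≰c+N | +-identityʳ (∑[ b < N ] 𝟙[ M ≤ c + b ]) =
  ≤-trans (∑-𝟙-upper c M N) (∸-monoˡ-≤ M (n≤1+n (N + c)))

-- Reindex a ↦ m − 1 − a.
∑-reflect : ∀ T m → ∑[ a < m ] ((a + T) ∸ m) ≡ ∑[ a < m ] (T ∸ suc a)
∑-reflect T zero    = refl
∑-reflect T (suc m) = begin
  (T ∸ suc m) + ∑[ a < m ] ((a + T) ∸ m)     ≡⟨ cong ((T ∸ suc m) +_) (∑-reflect T m) ⟩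
  (T ∸ suc m) + ∑[ a < m ] (T ∸ suc a)       ≡⟨ +-comm (T ∸ suc m) _ ⟩
  ∑[ a < m ] (T ∸ suc a) + (T ∸ suc m)       ≡⟨ ∑-snoc m (λ a → T ∸ suc a) ⟨
  ∑[ a < suc m ] (T ∸ suc a)                 ∎
  where open ≡-Reasoning

∑-triangle-bound : ∀ T m → ∑[ a < m ] (T ∸ suc a) + ∑[ a < m ] (T ∸ suc a) + T ≤ T * T
∑-triangle-bound zero    m       rewrite ∑-zero m = z≤n
∑-triangle-bound (suc T) zero    = m≤m*n (suc T) (suc T)
∑-triangle-bound (suc T) (suc m) = begin
  T + G + (T + G) + suc T                   ≡⟨ regroup T G ⟩
  G + G + T + (T + T + 1)                   ≤⟨ +-monoˡ-≤ (T + T + 1) (∑-triangle-bound T m) ⟩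
  T * T + (T + T + 1)                       ≡⟨ square-suc T ⟩
  suc T * suc T                             ∎
  where
  open ≤-Reasoning
  G = ∑[ a < m ] (T ∸ suc a)
  regroup : ∀ T G → T + G + (T + G) + suc T ≡ G + G + T + (T + T + 1)
  regroup = solve-∀
  square-suc : ∀ T → T * T + (T + T + 1) ≡ suc T * suc T
  square-suc = solve-∀

level : ∀ {m n} → Elem m n → ℕ
level (a , b) = toℕ a + toℕ b

≼-level-injective : ∀ {m n} {x y : Elem m n} → x ≼ y → level x ≡ level y → x ≡ y
≼-level-injective {x = a , b} {c , d} (a≤c , b≤d) a+b≡c+d =
  cong₂ _,_ (toℕ-injective a≡c)
            (toℕ-injective (+-cancelˡ-≡ (toℕ a) _ _ (trans a+b≡c+d (cong (_+ toℕ d) (sym a≡c)))))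
  where
  c+b≤a+b : toℕ c + toℕ b ≤ toℕ a + toℕ b
  c+b≤a+b = ≤-trans (+-monoʳ-≤ (toℕ c) b≤d) (≤-reflexive (sym a+b≡c+d))
  a≡c : toℕ a ≡ toℕ c
  a≡c = ≤-antisym a≤c (+-cancelʳ-≤ (toℕ b) _ _ c+b≤a+b)

comparable-level-injective : ∀ {m n} {x y : Elem m n} → Comparable x y → level x ≡ level y → x ≡ y
comparable-level-injective (inj₁ x≼y) eq = ≼-level-injective x≼y eq
comparable-level-injective (inj₂ y≼x) eq = sym (≼-level-injective y≼x (sym eq))

sum-map-elems : ∀ {m n} (f : Elem m n → ℕ) (F : ℕ → ℕ → ℕ) →
                (∀ a b → f (a , b) ≡ F (toℕ a) (toℕ b)) →
                sum (map f (elems m n)) ≡ ∑[ a < m ] ∑[ b < n ] F a b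
sum-map-elems {m} {n} f F f≡F = begin
  sum (map f (cartesianProduct (allFin m) (allFin n)))
    ≡⟨ sum-map-cartesianProduct f (allFin m) (allFin n) ⟩
  sum (map (λ a → sum (map (λ b → f (a , b)) (allFin n))) (allFin m))
    ≡⟨ cong sum (map-tabulate (λ a → a) (λ a → sum (map (λ b → f (a , b)) (allFin n)))) ⟩
  sum (tabulate (λ a → sum (map (λ b → f (a , b)) (allFin n))))
    ≡⟨ sum-tabulate m _ _ (λ a → trans (cong sum (map-tabulate (λ b → b) (λ b → f (a , b))))
                                        (sum-tabulate n _ _ (f≡F a))) ⟩
  ∑[ a < m ] ∑[ b < n ] F a b ∎
  where open ≡-Reasoning

module Corners {m n : ℕ} (T d : ℕ) (m+n≡2T+d : m + n ≡ 2 * T + d) where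

  -- Nonzero exactly outside the d + 1 middle levels T − 1, …, T + d − 1.
  corner : Elem m n → ℕ
  corner x = 𝟙[ suc (suc (level x)) ≤ T ] + 𝟙[ m + n ≤ level x + T ]

  offset : Elem m n → ℕ
  offset x = suc (level x) ∸ T

  middle-bounds : ∀ x → corner x ≡ 0 → T ≤ suc (level x) × offset x < suc d
  middle-bounds x corner≡0 = T≤1+lx , s≤s (m≤n+o⇒m∸n≤o (suc (level x)) T 1+lx≤T+d)
    where
    T≤1+lx : T ≤ suc (level x)
    T≤1+lx = ≤-pred (≰⇒> (𝟙≡0⇒≰ (m+n≡0⇒m≡0 _ corner≡0)))
    lx+T<m+n : level x + T < m + n
    lx+T<m+n = ≰⇒> (𝟙≡0⇒≰ (m+n≡0⇒n≡0 _ corner≡0))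
    m+n≡T+d+T : m + n ≡ T + d + T
    m+n≡T+d+T = trans m+n≡2T+d (2T+d≡T+d+T T d)
      where
      2T+d≡T+d+T : ∀ T d → 2 * T + d ≡ T + d + T
      2T+d≡T+d+T = solve-∀
    1+lx≤T+d : suc (level x) ≤ T + d
    1+lx≤T+d = +-cancelʳ-≤ T _ _ (subst (level x + T <_) m+n≡T+d+T lx+T<m+n)

  middle-offset-injective : ∀ x y → corner x ≡ 0 → corner y ≡ 0 → offset x ≡ offset y → level x ≡ level y
  middle-offset-injective x y x-mid y-mid offx≡offy = suc-injective (begin
    suc (level x)            ≡⟨ m∸n+n≡m (proj₁ (middle-bounds x x-mid)) ⟨
    offset x + T             ≡⟨ cong (_+ T) offx≡offy ⟩
    offset y + T             ≡⟨ m∸n+n≡m (proj₁ (middle-bounds y y-mid)) ⟩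
    suc (level y)            ∎)
    where open ≡-Reasoning

  chain-length-≤ : ∀ {C} → Unique C → IsChain C → length C ≤ suc d + sum (map corner C)
  chain-length-≤ {C} uniq chain = begin
    length C                                   ≤⟨ length≤filter+∑ middle? corner (λ _ → n≢0⇒n>0) C ⟩
    length middles + sum (map corner C)        ≤⟨ +-monoˡ-≤ _ middles≤1+d ⟩
    suc d + sum (map corner C)                 ∎
    where
    open ≤-Reasoning
    middle? : ∀ x → Dec (corner x ≡ 0)
    middle? x = corner x ≟ 0
    middles : List (Elem m n)
    middles = filter middle? C
    middles≤1+d : length middles ≤ suc d
    middles≤1+d = unique-length-≤ offset (Unique.filter⁺ middle? uniq)
      (All.map (λ {x} x-mid → proj₂ (middle-bounds x x-mid)) (all-filter middle? C))
      (λ {x} {y} x∈ y∈ eq →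
        let x∈C , x-mid = ∈-filter⁻ middle? x∈
            y∈C , y-mid = ∈-filter⁻ middle? y∈
        in comparable-level-injective (chain x y x∈C y∈C) (middle-offset-injective x y x-mid y-mid eq))

  blocks-prefix-≤ : ∀ t (Bs : List (List (Elem m n))) → All IsChain Bs → All Unique Bs →
    ∑[ i < t ] row (map length Bs) i ≤ t * suc d + sum (map corner (concat (take t Bs)))
  blocks-prefix-≤ zero    Bs       _              _              = z≤n
  blocks-prefix-≤ (suc t) []       _              _              = ≤-trans (≤-reflexive (∑-zero t)) z≤n
  blocks-prefix-≤ (suc t) (C ∷ Bs) (C-chain ∷ chains) (C-uniq ∷ uniqs)
    rewrite map-++ corner C (concat (take t Bs)) | sum-++ (map corner C) (map corner (concat (take t Bs))) =
    ≤-trans (+-mono-≤ (chain-length-≤ C-uniq C-chain) (blocks-prefix-≤ t Bs chains uniqs))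
            (≤-reflexive (interchange (suc d) (sum (map corner C)) (t * suc d) _))
    where
    interchange : ∀ a b c d → a + b + (c + d) ≡ a + c + (b + d)
    interchange = solve-∀

  corners-total : sum (map corner (elems m n)) + T ≤ T * T
  corners-total = begin
    sum (map corner (elems m n)) + T
      ≡⟨ cong (_+ T) (sum-map-elems corner (λ a b → 𝟙[ 2 + a + b ≤ T ] + 𝟙[ m + n ≤ a + T + b ]) corner≡) ⟩
    ∑[ a < m ] ∑[ b < n ] (𝟙[ 2 + a + b ≤ T ] + 𝟙[ m + n ≤ a + T + b ]) + T
      ≤⟨ +-monoˡ-≤ T (∑-mono-≤ m (λ a _ → row-bound a)) ⟩
    ∑[ a < m ] ((T ∸ suc a) + ((a + T) ∸ m)) + T
      ≡⟨ cong (_+ T) (trans (∑-distrib-+ m _ _) (cong (G +_) (∑-reflect T m))) ⟩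
    G + G + T
      ≤⟨ ∑-triangle-bound T m ⟩
    T * T ∎
    where
    open ≤-Reasoning
    G = ∑[ a < m ] (T ∸ suc a)
    corner≡ : ∀ a b → corner (a , b) ≡ 𝟙[ 2 + toℕ a + toℕ b ≤ T ] + 𝟙[ m + n ≤ toℕ a + T + toℕ b ]
    corner≡ a b = cong (𝟙[ 2 + toℕ a + toℕ b ≤ T ] +_) (cong 𝟙[ m + n ≤_] (+-swap (toℕ a) (toℕ b) T))
      where
      +-swap : ∀ a b T → a + b + T ≡ a + T + b
      +-swap = solve-∀
    row-bound : ∀ a → ∑[ b < n ] (𝟙[ 2 + a + b ≤ T ] + 𝟙[ m + n ≤ a + T + b ]) ≤
                      (T ∸ suc a) + ((a + T) ∸ m)
    row-bound a = begin
      ∑[ b < n ] (𝟙[ 2 + a + b ≤ T ] + 𝟙[ m + n ≤ a + T + b ])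
        ≡⟨ ∑-distrib-+ n _ _ ⟩
      ∑[ b < n ] 𝟙[ 2 + a + b ≤ T ] + ∑[ b < n ] 𝟙[ m + n ≤ a + T + b ]
        ≤⟨ +-mono-≤ (∑-𝟙-lower (2 + a) T n) (∑-𝟙-upper (a + T) (m + n) n) ⟩
      (T ∸ suc a) + ((n + (a + T)) ∸ (m + n))
        ≡⟨ cong (λ k → (T ∸ suc a) + ((n + (a + T)) ∸ k)) (+-comm m n) ⟩
      (T ∸ suc a) + ((n + (a + T)) ∸ (n + m))
        ≡⟨ cong ((T ∸ suc a) +_) ([m+n]∸[m+o]≡n∸o n (a + T) m) ⟩
      (T ∸ suc a) + ((a + T) ∸ m) ∎

  chain-partition-prefix-bound : (Bs : List (List (Elem m n))) → All IsChain Bs → concat Bs ↭ elems m n →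
                 ∑[ i < T ] row (map length Bs) i + T ≤ T * suc d + T * T
  chain-partition-prefix-bound Bs chains partition = begin
    ∑[ i < T ] row (map length Bs) i + T
      ≤⟨ +-monoˡ-≤ T (blocks-prefix-≤ T Bs chains blocks-unique) ⟩
    T * suc d + sum (map corner (concat (take T Bs))) + T
      ≤⟨ +-monoˡ-≤ T (+-monoʳ-≤ (T * suc d) (sum-map-concat-take corner T Bs)) ⟩
    T * suc d + sum (map corner (concat Bs)) + T
      ≡⟨ cong (λ k → T * suc d + k + T) (sum-↭ (map⁺ corner partition)) ⟩
    T * suc d + sum (map corner (elems m n)) + T
      ≡⟨ +-assoc (T * suc d) _ T ⟩
    T * suc d + (sum (map corner (elems m n)) + T)
      ≤⟨ +-monoʳ-≤ (T * suc d) corners-total ⟩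
    T * suc d + T * T ∎
    where
    open ≤-Reasoning
    elems-unique : Unique (elems m n)
    elems-unique = Unique.cartesianProduct⁺ (Unique.allFin⁺ m) (Unique.allFin⁺ n)
    blocks-unique : All Unique Bs
    blocks-unique = Unique-concat⁻ Bs (Unique-↭ (↭-sym partition) elems-unique)

scp-prefix-bound : ∀ {m n λs} T → 2 * T ≤ m + n → SCP m n λs →
                   ∑[ i < T ] row λs i + (T + T * T) ≤ T * suc (m + n)
scp-prefix-bound {m} {n} {λs} T 2T≤m+n scp = begin
  ∑[ i < T ] row λs i + (T + T * T)
    ≡⟨ cong (λ ls → ∑[ i < T ] row ls i + (T + T * T)) sizes ⟨
  ∑[ i < T ] row (map length blocks) i + (T + T * T)
    ≡⟨ +-assoc _ T (T * T) ⟨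
  ∑[ i < T ] row (map length blocks) i + T + T * T
    ≤⟨ +-monoˡ-≤ (T * T) (Corners.chain-partition-prefix-bound T d m+n≡2T+d blocks chains isPart) ⟩
  T * suc d + T * T + T * T
    ≡⟨ regroup T d ⟩
  T * suc (2 * T + d)
    ≡⟨ cong (λ m+n → T * suc m+n) m+n≡2T+d ⟨
  T * suc (m + n) ∎
  where
  open ≤-Reasoning
  open SCP scp
  d = m + n ∸ 2 * T
  m+n≡2T+d : m + n ≡ 2 * T + d
  m+n≡2T+d = sym (m+[n∸m]≡n 2T≤m+n)
  regroup : ∀ T d → T * suc d + T * T + T * T ≡ T * suc (2 * T + d)
  regroup = solve-∀

-- The shape ρ

row-applyUpTo-++ : ∀ N (f : ℕ → ℕ) xs {j} → j < N → row (applyUpTo f N ++ xs) j ≡ f j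
row-applyUpTo-++ (suc N) f xs {zero}  _         = refl
row-applyUpTo-++ (suc N) f xs {suc j} (s≤s j<N) = row-applyUpTo-++ N (λ i → f (suc i)) xs j<N

∑-∸-evens : ∀ A t → 2 * t ≤ A → ∑[ j < t ] (A ∸ 2 * suc j) + (t + t * t) ≡ t * A
∑-∸-evens A zero    _      = refl
∑-∸-evens A (suc t) 2t+2≤A = begin
  ∑[ j < suc t ] (A ∸ 2 * suc j) + (suc t + suc t * suc t)
    ≡⟨ cong (_+ (suc t + suc t * suc t)) (∑-snoc t (λ j → A ∸ 2 * suc j)) ⟩
  ∑[ j < t ] (A ∸ 2 * suc j) + (A ∸ 2 * suc t) + (suc t + suc t * suc t)
    ≡⟨ regroup (∑[ j < t ] (A ∸ 2 * suc j)) (A ∸ 2 * suc t) t ⟩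
  (∑[ j < t ] (A ∸ 2 * suc j) + (t + t * t)) + ((A ∸ 2 * suc t) + 2 * suc t)
    ≡⟨ cong₂ _+_ (∑-∸-evens A t (≤-trans (*-monoʳ-≤ 2 (n≤1+n t)) 2t+2≤A)) (m∸n+n≡m 2t+2≤A) ⟩
  t * A + A
    ≡⟨ +-comm (t * A) A ⟩
  suc t * A ∎
  where
  open ≡-Reasoning
  regroup : ∀ S D t → S + D + (suc t + suc t * suc t) ≡ S + (t + t * t) + (D + 2 * suc t)
  regroup = solve-∀

rho-row : ∀ n k {j} → j < n ∸ 1 → row (rho n k) j ≡ (2 * n + k + 1) ∸ 2 * suc j
rho-row n k = row-applyUpTo-++ (n ∸ 1) (λ j → (2 * n + k + 1) ∸ 2 * suc j) _

rho-prefix : ∀ n k {t} → t ≤ n ∸ 1 → ∑[ j < t ] row (rho n k) j + (t + t * t) ≡ t * suc (n + k + n)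
rho-prefix n k {t} t≤n-1 = begin
  ∑[ j < t ] row (rho n k) j + (t + t * t)
    ≡⟨ cong (_+ (t + t * t)) (∑-cong t (λ j j<t → rho-row n k (<-≤-trans j<t t≤n-1))) ⟩
  ∑[ j < t ] (A ∸ 2 * suc j) + (t + t * t)
    ≡⟨ ∑-∸-evens A t 2t≤A ⟩
  t * A
    ≡⟨ cong (t *_) (shape n k) ⟩
  t * suc (n + k + n) ∎
  where
  open ≡-Reasoning
  A = 2 * n + k + 1
  2t≤A : 2 * t ≤ A
  2t≤A = ≤-trans (*-monoʳ-≤ 2 (≤-trans t≤n-1 (m∸n≤m n 1))) (≤-trans (m≤m+n (2 * n) k) (m≤m+n _ 1))
  shape : ∀ n k → 2 * n + k + 1 ≡ suc (n + k + n)
  shape = solve-∀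

lemma4p2 : (n k : ℕ) → 1 ≤ n → 1 ≤ k →
    (λs s : List ℕ) (T : SpecialRHT (rho n k) s) → HasContent T λs →
    SCP (n + k) n λs →
    ∀ i → i < n ∸ 1 →
      row λs i ≡ row (rho n k) i × row λs i ≡ (2 * n + k + 1) ∸ 2 * suc i
lemma4p2 n k _ _ λs s T content scp i i<n-1 = λi≡ρi , trans λi≡ρi (rho-row n k i<n-1)
  where
  prefix≡ : ∀ t → t ≤ n ∸ 1 → ∑[ j < t ] row λs j ≡ ∑[ j < t ] row (rho n k) j
  prefix≡ t t≤n-1 = ≤-antisym
    (+-cancelʳ-≤ (t + t * t) _ _
      (≤-trans (scp-prefix-bound t 2t≤m+n scp) (≤-reflexive (sym (rho-prefix n k t≤n-1)))))
    (specialRHT-dominance T λs content t)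
    where
    t≤n : t ≤ n
    t≤n = ≤-trans t≤n-1 (m∸n≤m n 1)
    2t≤m+n : 2 * t ≤ n + k + n
    2t≤m+n = +-mono-≤ (≤-trans t≤n (m≤m+n n k)) (subst (_≤ n) (sym (+-identityʳ t)) t≤n)
  λi≡ρi : row λs i ≡ row (rho n k) i
  λi≡ρi = prefix-sums-determine (n ∸ 1) prefix≡ i<n-1
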